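{- Let $B=10$. The smallest Gaussian happy numbers of heights $0$, $1$, $2$ are, respectively, $1$; $-1$; and $i,-i$. For heights $h=3,4,5,6$, the smallest Gaussian happy numbers of height $h$ are exactly $z,-z,\pm\overline{z},\pm iz,\pm i\overline{z}$, where $z=12+12i$ for $h=3$, $z=4+4i$ for $h=4$, $z=7$ for $h=5$, and $z=5+19i$ for $h=6$.
   Context: Every nonzero Gaussian integer $a+bi$ is written uniquely as $a+bi=\sum_{j=0}^n (a_j+b_ji)10^j$ with $a_j,b_j\in\mathbb{Z}$, $a_n,b_n$ not both $0$, and for each $j$: $|a_j|\le 9$, $|b_j|\le 9$, $\operatorname{sgn}(a)a_j\ge 0$, $\operatorname{sgn}(b)b_j\ge 0$. The Gaussian happy function $S_{10}:\mathbb{Z}[i]\to\mathbb{Z}[i]$ is defined by $S_{10}(0)=0$ and $S_{10}(a+bi)=\sum_{j=0}^n (a_j+b_ji)^2$. A Gaussian integer $z$ is Gaussian happy if $S_{10}^k(z)=1$ for some $k\ge1$. The height of a Gaussian happy number $z$ is the least $k\in\mathbb{Z}_{\ge0}$ with $S_{10}^k(z)=1$ ($S_{10}^0$ is the identity). "Smallest" means of minimal complex absolute value among Gaussian happy numbers of the given height. -}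

module Defs where

open import Data.Nat as ℕ using (ℕ; zero; suc; _%_; _/_)
open import Data.Integer as ℤ using (ℤ; +_; -[1+_]; _+_; _-_; _*_; -_; ∣_∣)
open import Data.Product using (_×_; _,_; Σ; ∃)
open import Data.List using (List; []; _∷_)
open import Data.List.Membership.Propositional using (_∈_)
open import Relation.Binary.PropositionalEquality using (_≡_; _≢_)
open import Relation.Nullary using (¬_)
open import Function.Bundles using (_⇔_)

-- Gaussian integers a + b i represented as pairs (a , b)
ℤ[i] : Set
ℤ[i] = ℤ × ℤ

_+ᵍ_ : ℤ[i] → ℤ[i] → ℤ[i]
(a , b) +ᵍ (c , d) = (a + c , b + d)

_*ᵍ_ : ℤ[i] → ℤ[i] → ℤ[i]
(a , b) *ᵍ (c , d) = (a * c - b * d , a * d + b * c)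

negᵍ : ℤ[i] → ℤ[i]
negᵍ (a , b) = (- a , - b)

conjᵍ : ℤ[i] → ℤ[i]
conjᵍ (a , b) = (a , - b)

iᵍ : ℤ[i]
iᵍ = (+ 0 , + 1)

oneᵍ : ℤ[i]
oneᵍ = (+ 1 , + 0)

zeroᵍ : ℤ[i]
zeroᵍ = (+ 0 , + 0)

normᵍ : ℤ[i] → ℕ
normᵍ (a , b) = ∣ a ∣ ℕ.* ∣ a ∣ ℕ.+ ∣ b ∣ ℕ.* ∣ b ∣

digit : ℕ → ℕ → ℕ
digit zero    m = m % 10
digit (suc j) m = digit j (m / 10)

sgn : ℤ → ℤ
sgn (+ zero)  = + 0
sgn (+ suc _) = + 1
sgn -[1+ _ ]  = - (+ 1)

sdigit : ℤ → ℕ → ℤ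
sdigit a j = sgn a * + digit j ∣ a ∣

sumᵍ : ℕ → (ℕ → ℤ[i]) → ℤ[i]
sumᵍ zero    f = zeroᵍ
sumᵍ (suc n) f = sumᵍ n f +ᵍ f n

-- the Gaussian happy function S_10: sum of squares of the digits
-- a_j + b_j i; digits beyond the length n are zero, so summing over
-- j < 1 + |a| + |b| (which exceeds the number of digits) is the same sum.
S₁₀ : ℤ[i] → ℤ[i]
S₁₀ (a , b) = sumᵍ (suc (∣ a ∣ ℕ.+ ∣ b ∣))
  (λ j → let d = (sdigit a j , sdigit b j) in d *ᵍ d)

iter : ℕ → (ℤ[i] → ℤ[i]) → ℤ[i] → ℤ[i]
iter zero    f z = z
iter (suc k) f z = f (iter k f z)

GaussianHappy : ℤ[i] → Set
GaussianHappy z = Σ ℕ λ k → iter (suc k) S₁₀ z ≡ oneᵍ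

HasHeight : ℕ → ℤ[i] → Set
HasHeight h z = GaussianHappy z × iter h S₁₀ z ≡ oneᵍ
              × (∀ k → k ℕ.< h → iter k S₁₀ z ≢ oneᵍ)

Smallest : ℕ → ℤ[i] → Set
Smallest h z = HasHeight h z × (∀ w → HasHeight h w → normᵍ z ℕ.≤ normᵍ w)

SmallestAre : ℕ → List ℤ[i] → Set
SmallestAre h L = ∀ w → Smallest h w ⇔ w ∈ L

orbit : ℤ[i] → List ℤ[i]
orbit z = z ∷ negᵍ z ∷ conjᵍ z ∷ negᵍ (conjᵍ z)
        ∷ (iᵍ *ᵍ z) ∷ negᵍ (iᵍ *ᵍ z) ∷ (iᵍ *ᵍ conjᵍ z) ∷ negᵍ (iᵍ *ᵍ conjᵍ z) ∷ []

{-# OPTIONS --safe #-}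
-- A Gaussian integer of norm at most N lies in the box |a|, |b| < B as soon as N < B², so
-- whether some number of height h is at most as large as z is a finite question: it is
-- settled by iterating S₁₀ on every point of that box.

module Submission where

open import Defs
open import Data.Integer using (+_; -_)
open import Data.Product using (_×_; _,_)
open import Data.List using (_∷_; [])

open import Data.Nat as ℕ using (ℕ; zero; suc; _≤_; _<_; z≤n; s≤s; _^_; _≤?_; _<?_)
open import Data.Nat.Properties
open import Data.Nat.DivMod using (m<n*o⇒m/o<n)
open import Data.Integer as ℤ using (ℤ; -[1+_]; ∣_∣)
import Data.Integer.Properties as ℤ
open import Data.Product using (proj₁; proj₂)
open import Data.Product.Properties using (≡-dec)
open import Data.List.Relation.Unary.All as All using (All; _∷_)
open import Data.List.Membership.Propositional using (_∈_)
open import Data.Sum using (inj₁; inj₂)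
open import Function using (_∘_)
open import Function.Bundles using (mk⇔)
open import Relation.Binary.PropositionalEquality
open import Relation.Nullary using (Dec; yes; no; ¬?)
open import Relation.Nullary.Decidable using (True; toWitness; map′; _×-dec_; _→-dec_)
open import Relation.Unary using (Pred; Decidable)

n<m^n : ∀ {m} → 1 < m → ∀ n → n < m ^ n
n<m^n 1<m zero    = s≤s z≤n
n<m^n 1<m (suc n) = ≤-<-trans (n<m^n 1<m n) (^-monoʳ-< _ 1<m (n<1+n n))

digit-vanishes : ∀ j m → m < 10 ^ j → digit j m ≡ 0
digit-vanishes zero    zero    _   = refl
digit-vanishes zero    (suc m) (s≤s ())
digit-vanishes (suc j) m       m<  =
  digit-vanishes j (m ℕ./ 10) (m<n*o⇒m/o<n (subst (m <_) (*-comm 10 (10 ^ j)) m<))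

sdigit-vanishes : ∀ a j → ∣ a ∣ < 10 ^ j → sdigit a j ≡ + 0
sdigit-vanishes a j a< =
  trans (cong (λ d → sgn a ℤ.* + d) (digit-vanishes j ∣ a ∣ a<)) (ℤ.*-zeroʳ (sgn a))

AtMostDigits : ℕ → ℤ[i] → Set
AtMostDigits n (a , b) = ∣ a ∣ < 10 ^ n × ∣ b ∣ < 10 ^ n

atMostDigits? : ∀ n → Decidable (AtMostDigits n)
atMostDigits? n (a , b) = ∣ a ∣ <? 10 ^ n ×-dec ∣ b ∣ <? 10 ^ n

atMostDigits-mono : ∀ {m n} w → m ≤ n → AtMostDigits m w → AtMostDigits n w
atMostDigits-mono (a , b) m≤n (a< , b<) =
  <-≤-trans a< (^-monoʳ-≤ 10 m≤n) , <-≤-trans b< (^-monoʳ-≤ 10 m≤n)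

atMostDigits-size : ∀ w → AtMostDigits (suc (∣ proj₁ w ∣ ℕ.+ ∣ proj₂ w ∣)) w
atMostDigits-size (a , b) =
    <-trans (s≤s (m≤m+n ∣ a ∣ ∣ b ∣)) (n<m^n (s≤s (s≤s z≤n)) _)
  , <-trans (s≤s (m≤n+m ∣ b ∣ ∣ a ∣)) (n<m^n (s≤s (s≤s z≤n)) _)

digitSquare : ℤ[i] → ℕ → ℤ[i]
digitSquare (a , b) j = let d = (sdigit a j , sdigit b j) in d *ᵍ d

digitSquareSum : ℕ → ℤ[i] → ℤ[i]
digitSquareSum n w = sumᵍ n (digitSquare w)

S₁₀-as-digitSquareSum : ∀ w → S₁₀ w ≡ digitSquareSum (suc (∣ proj₁ w ∣ ℕ.+ ∣ proj₂ w ∣)) w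
S₁₀-as-digitSquareSum (a , b) = refl

digitSquare-vanishes : ∀ w j → AtMostDigits j w → digitSquare w j ≡ zeroᵍ
digitSquare-vanishes (a , b) j (a< , b<) =
  cong₂ (λ x y → (x , y) *ᵍ (x , y)) (sdigit-vanishes a j a<) (sdigit-vanishes b j b<)

+ᵍ-identityʳ : ∀ x → x +ᵍ zeroᵍ ≡ x
+ᵍ-identityʳ (x , y) = cong₂ _,_ (ℤ.+-identityʳ x) (ℤ.+-identityʳ y)

sumᵍ-vanishing-tail : ∀ (f : ℕ → ℤ[i]) {n} → (∀ j → n ≤ j → f j ≡ zeroᵍ) →
                      ∀ {m} → n ≤ m → sumᵍ m f ≡ sumᵍ n f
sumᵍ-vanishing-tail f vanish {zero}  z≤n = refl
sumᵍ-vanishing-tail f vanish {suc m} n≤1+m with m≤n⇒m<n∨m≡n n≤1+m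
... | inj₂ refl      = refl
... | inj₁ (s≤s n≤m) = begin
  sumᵍ m f +ᵍ f m     ≡⟨ cong (sumᵍ m f +ᵍ_) (vanish m n≤m) ⟩
  sumᵍ m f +ᵍ zeroᵍ   ≡⟨ +ᵍ-identityʳ (sumᵍ m f) ⟩
  sumᵍ m f            ≡⟨ sumᵍ-vanishing-tail f vanish n≤m ⟩
  sumᵍ _ f            ∎
  where open ≡-Reasoning

digitSquareSum-stable : ∀ {m n} w → AtMostDigits m w → AtMostDigits n w →
                        digitSquareSum m w ≡ digitSquareSum n w
digitSquareSum-stable {m} {n} w fits-m fits-n with ≤-total n m
... | inj₁ n≤m = sumᵍ-vanishing-tail (digitSquare w) (vanishesFrom fits-n) n≤m
  where
  vanishesFrom : ∀ {k} → AtMostDigits k w → ∀ j → k ≤ j → digitSquare w j ≡ zeroᵍ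
  vanishesFrom fits j k≤j = digitSquare-vanishes w j (atMostDigits-mono w k≤j fits)
... | inj₂ m≤n = sym (sumᵍ-vanishing-tail (digitSquare w) (vanishesFrom fits-m) m≤n)
  where
  vanishesFrom : ∀ {k} → AtMostDigits k w → ∀ j → k ≤ j → digitSquare w j ≡ zeroᵍ
  vanishesFrom fits j k≤j = digitSquare-vanishes w j (atMostDigits-mono w k≤j fits)

S₁₀-of-atMostDigits : ∀ {n} w → AtMostDigits n w → S₁₀ w ≡ digitSquareSum n w
S₁₀-of-atMostDigits w fits =
  trans (S₁₀-as-digitSquareSum w) (digitSquareSum-stable {suc (∣ proj₁ w ∣ ℕ.+ ∣ proj₂ w ∣)} w (atMostDigits-size w) fits)

-- S₁₀ sums over 1 + |a| + |b| digit positions; every value reached in the search has at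
-- most three digits, and there this variant only looks at three positions.
S₁₀′ : ℤ[i] → ℤ[i]
S₁₀′ w with atMostDigits? 3 w
... | yes _ = digitSquareSum 3 w
... | no  _ = S₁₀ w

S₁₀≗S₁₀′ : ∀ w → S₁₀ w ≡ S₁₀′ w
S₁₀≗S₁₀′ w with atMostDigits? 3 w
... | yes fits = S₁₀-of-atMostDigits {3} w fits
... | no  _    = refl

iter-cong : ∀ {f g : ℤ[i] → ℤ[i]} → (∀ w → f w ≡ g w) → ∀ k w → iter k f w ≡ iter k g w
iter-cong f≗g zero    w = refl
iter-cong {f} f≗g (suc k) w = trans (cong f (iter-cong f≗g k w)) (f≗g _)

_≟ᵍ_ : (x y : ℤ[i]) → Dec (x ≡ y)
_≟ᵍ_ = ≡-dec ℤ._≟_ ℤ._≟_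

open import Data.List.Membership.DecPropositional _≟ᵍ_ using (_∈?_)

S₁₀-one : S₁₀ oneᵍ ≡ oneᵍ
S₁₀-one = refl

happy-if-reaches-one : ∀ h z → iter h S₁₀ z ≡ oneᵍ → GaussianHappy z
happy-if-reaches-one h z reaches = h , trans (cong S₁₀ reaches) S₁₀-one

hasHeight? : ∀ h → Decidable (HasHeight h)
hasHeight? h z = map′ fromS₁₀′ toS₁₀′
  (iter h S₁₀′ z ≟ᵍ oneᵍ ×-dec allUpTo? (λ k → ¬? (iter k S₁₀′ z ≟ᵍ oneᵍ)) h)
  where
  same : ∀ k → iter k S₁₀ z ≡ iter k S₁₀′ z
  same k = iter-cong S₁₀≗S₁₀′ k z
  fromS₁₀′ : _ → HasHeight h z
  fromS₁₀′ (reaches , notBefore) =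
      happy-if-reaches-one h z (trans (same h) reaches)
    , trans (same h) reaches
    , λ k k<h → notBefore k<h ∘ trans (sym (same k))
  toS₁₀′ : HasHeight h z → _
  toS₁₀′ (_ , reaches , notBefore) =
    trans (sym (same h)) reaches , λ {k} k<h → notBefore k k<h ∘ trans (same k)

m*m<n*n⇒m<n : ∀ {m n} → m ℕ.* m < n ℕ.* n → m < n
m*m<n*n⇒m<n mm<nn = ≰⇒> (λ n≤m → <⇒≱ mm<nn (*-mono-≤ n≤m n≤m))

inBox-if-normᵍ< : ∀ {B} a b → normᵍ (a , b) < B ℕ.* B → ∣ a ∣ < B × ∣ b ∣ < B
inBox-if-normᵍ< a b norm< =
    m*m<n*n⇒m<n (≤-<-trans (m≤m+n (∣ a ∣ ℕ.* ∣ a ∣) _) norm<)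
  , m*m<n*n⇒m<n (≤-<-trans (m≤n+m (∣ b ∣ ℕ.* ∣ b ∣) _) norm<)

allAbs<? : ∀ {p} {P : Pred ℤ p} → Decidable P → ∀ B → Dec (∀ a → ∣ a ∣ < B → P a)
allAbs<? {P = P} P? B = map′ fromℕ toℕ (allUpTo? (λ n → P? (+ n) ×-dec P? (- + n)) B)
  where
  fromℕ : (∀ {n} → n < B → P (+ n) × P (- + n)) → ∀ a → ∣ a ∣ < B → P a
  fromℕ both (+ n)    n<B = proj₁ (both n<B)
  fromℕ both -[1+ n ] n<B = proj₂ (both n<B)
  toℕ : (∀ a → ∣ a ∣ < B → P a) → ∀ {n} → n < B → P (+ n) × P (- + n)
  toℕ all {n} n<B = all (+ n) n<B , all (- + n) (subst (_< B) (sym (ℤ.∣-i∣≡∣i∣ (+ n))) n<B)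

InBox : ∀ {p} → ℕ → Pred ℤ[i] p → Set p
InBox B P = ∀ a → ∣ a ∣ < B → ∀ b → ∣ b ∣ < B → P (a , b)

allInBox? : ∀ {p} {P : Pred ℤ[i] p} → Decidable P → ∀ B → Dec (InBox B P)
allInBox? P? B = allAbs<? (λ a → allAbs<? (λ b → P? (a , b)) B) B

smallestAre-if-complete : ∀ {h z L} →
  All (λ w → HasHeight h w × normᵍ w ≡ normᵍ z) (z ∷ L) →
  (∀ w → normᵍ w ≤ normᵍ z → HasHeight h w → w ∈ z ∷ L) →
  SmallestAre h (z ∷ L)
smallestAre-if-complete {h} {z} {L} members complete w = mk⇔ toList fromList
  where
  atLeast-z : ∀ v → HasHeight h v → normᵍ z ≤ normᵍ v
  atLeast-z v height = ≮⇒≥ λ v<z →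
    <-irrefl (proj₂ (All.lookup members (complete v (<⇒≤ v<z) height))) v<z
  toList : Smallest h w → w ∈ z ∷ L
  toList (height , minimal) = complete w (minimal z (proj₁ (All.head members))) height
  fromList : w ∈ z ∷ L → Smallest h w
  fromList w∈ with All.lookup members w∈
  ... | height , norm≡ = height , λ v hv → subst (_≤ normᵍ v) (sym norm≡) (atLeast-z v hv)

smallestAre-byBoxSearch : ∀ h z {L} B →
  {True (normᵍ z <? B ℕ.* B)} →
  {True (All.all? (λ w → hasHeight? h w ×-dec normᵍ w ℕ.≟ normᵍ z) (z ∷ L))} →
  {True (allInBox? (λ w → normᵍ w ≤? normᵍ z →-dec hasHeight? h w →-dec w ∈? z ∷ L) B)} →
  SmallestAre h (z ∷ L)
smallestAre-byBoxSearch h z {L} B {z<B²} {members} {search} =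
  smallestAre-if-complete (toWitness members) complete
  where
  complete : ∀ w → normᵍ w ≤ normᵍ z → HasHeight h w → w ∈ z ∷ L
  complete (a , b) w≤z with inBox-if-normᵍ< a b (≤-<-trans w≤z (toWitness z<B²))
  ... | a<B , b<B = toWitness search a a<B b b<B w≤z

theorem10 : SmallestAre 0 (oneᵍ ∷ [])
          × SmallestAre 1 (negᵍ oneᵍ ∷ [])
          × SmallestAre 2 (iᵍ ∷ negᵍ iᵍ ∷ [])
          × SmallestAre 3 (orbit (+ 12 , + 12))
          × SmallestAre 4 (orbit (+ 4 , + 4))
          × SmallestAre 5 (orbit (+ 7 , + 0))
          × SmallestAre 6 (orbit (+ 5 , + 19))
theorem10 = smallestAre-byBoxSearch 0 oneᵍ 2
          , smallestAre-byBoxSearch 1 (negᵍ oneᵍ) 2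
          , smallestAre-byBoxSearch 2 iᵍ 2
          , smallestAre-byBoxSearch 3 (+ 12 , + 12) 17
          , smallestAre-byBoxSearch 4 (+ 4 , + 4) 6
          , smallestAre-byBoxSearch 5 (+ 7 , + 0) 8
          , smallestAre-byBoxSearch 6 (+ 5 , + 19) 20
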